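{- Let $a \in \{1,5,7,11,13,17\}$ and let $N$ be a positive integer with $N \equiv a^2 \pmod{36}$. Put $N_0 = \frac{N-a^2}{36}$ and $p_{ -1}=0$. For $i = 0,1,2,\dots$ define recursively: $b_{i+1}$ is the unique element of $\{1,2,\dots,9\}$ with $N_i \equiv a\, b_{i+1} \pmod 9$; $\mathrm{frac}_i = \frac{N_i - a\, b_{i+1}}{9}$; $p_i = p_{i-1} + 9^i b_{i+1}$; $f_i = b_{i+1}\,(p_i + p_{i-1})$; $N_{i+1} = \mathrm{frac}_i - f_i$; and stop at the first index $i$ for which $\mathrm{frac}_i \le f_i$. Then this procedure stops after finitely many steps, and there exists an integer $p \ge 1$ with $N = (a+18p)^2$ if and only if at the stopping index $i$ one has $\mathrm{frac}_i = f_i$. In that case $p = p_i$ (so $\sqrt{N} = a + 18 p_i$), and this $p$ is unique.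
   Context: Every positive integer $p$ has a unique representation $p=\sum_{i=0}^{m} 9^i b_{i+1}$ with all digits $b_{i+1}\in\{1,\dots,9\}$; the procedure determines these digits one at a time. Since $a$ is not divisible by $3$, the digit $b_{i+1}$ in each step exists and is unique. The quantities $N_i$, $\mathrm{frac}_i$, $f_i$ are integers (possibly negative). -}

module Defs where

open import Data.Nat as ℕ using (ℕ; zero; suc; _^_)
open import Data.Integer as ℤ using (ℤ; +_; _-_; _*_; _+_)
open import Data.Integer.DivMod using (_/_; _%ℕ_)
open import Data.List using (List; []; _∷_)
open import Data.Bool using (if_then_else_)
open import Data.Product using (_×_; _,_; proj₁; proj₂)

-- First b in the list with n ≡ a*b (mod 9); default 9 (never used when 3 ∤ a,
-- since then exactly one b ∈ {1..9} satisfies the congruence).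
digitFrom : ℕ → ℤ → List ℕ → ℕ
digitFrom a n [] = 9
digitFrom a n (b ∷ bs) =
  if ((n - + a * + b) %ℕ 9) ℕ.≡ᵇ 0 then b else digitFrom a n bs

digit : ℕ → ℤ → ℕ
digit a n = digitFrom a n (1 ∷ 2 ∷ 3 ∷ 4 ∷ 5 ∷ 6 ∷ 7 ∷ 8 ∷ 9 ∷ [])

N₀ : ℕ → ℕ → ℤ
N₀ a N = (+ N - + (a ^ 2)) / (+ 36)

-- state a N i = (N_i , p_{i-1})
state : ℕ → ℕ → ℕ → ℤ × ℤ
state a N zero = N₀ a N , + 0
state a N (suc i) =
  let Ni   = proj₁ (state a N i)
      pp   = proj₂ (state a N i)
      b    = digit a Ni
      frac = (Ni - + a * + b) / (+ 9)
      p    = pp + + (9 ^ i) * + b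
      f    = + b * (p + pp)
  in (frac - f) , p

NAt : ℕ → ℕ → ℕ → ℤ
NAt a N i = proj₁ (state a N i)

pPrev : ℕ → ℕ → ℕ → ℤ
pPrev a N i = proj₂ (state a N i)

bAt : ℕ → ℕ → ℕ → ℕ
bAt a N i = digit a (NAt a N i)

fracAt : ℕ → ℕ → ℕ → ℤ
fracAt a N i = (NAt a N i - + a * + bAt a N i) / (+ 9)

pAt : ℕ → ℕ → ℕ → ℤ
pAt a N i = pPrev a N i + + (9 ^ i) * + bAt a N i

fAt : ℕ → ℕ → ℕ → ℤ
fAt a N i = + bAt a N i * (pAt a N i + pPrev a N i)

Stops : ℕ → ℕ → ℕ → Set
Stops a N i = fracAt a N i ℤ.≤ fAt a N i

{-# OPTIONS --safe #-}
-- Write quad a x = a x + 9 x², so that (a + 18 p)² = a² + 36 · quad a p and, under the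
-- congruence, N = (a + 18 p)² iff N₀ = quad a p.  Since 9 divides N_i − a b_{i+1}, induction
-- gives the invariant 9^i N_i + quad a p_{i−1} = N₀, hence 9^{i+1} (frac_i − f_i) = N₀ − quad a p_i:
-- the procedure stops at the first i with N₀ ≤ quad a p_i, and then frac_i = f_i iff N₀ = quad a p_i.
-- As p_i ≥ i + 1, it stops by step |N₀|.  If N₀ = quad a p with p ≥ 1, write p = p_{i−1} + 9^i r;
-- the invariant gives N_i = r (a + 9 (2 p_{i−1} + 9^i r)) ≡ a r (mod 9), and as a is invertible
-- mod 9, r ≡ b_{i+1}, i.e. p = p_i + 9^{i+1} s with 9 s = r − b_{i+1}.  Before the stop p_i < p,
-- so s > 0; at the stop p ≤ p_i while 9 s ≥ 1 − 9, so s = 0 and p = p_i.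
module Submission where

open import Defs
open import Data.List.Base using (List; []; _∷_)
open import Data.List.Membership.Propositional using (_∈_)
open import Data.List.Relation.Unary.Any using (here; there)
open import Data.Product.Base using (_×_; _,_; proj₁; proj₂; ∃-syntax)
open import Function.Base using (_∘_)
open import Function.Bundles using (_⇔_; mk⇔; Equivalence)
open import Function.Construct.Composition using (_⇔-∘_)
open import Relation.Binary.PropositionalEquality
open import Relation.Nullary using (¬_; yes; no; contradiction)
open import Function.Construct.Symmetry using (⇔-sym)
open import Relation.Unary using (Decidable)

module _ where
  open import Data.Nat.Base as ℕ using (ℕ; zero; suc; z≤n; s≤s; _^_)
  import Data.Nat.Properties as ℕ
  import Data.Nat.DivMod as ℕ
  import Data.Nat.Tactic.RingSolver as ℕ
  open import Data.Nat.Induction using (<-rec)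
  open import Data.Integer.Base
    using (ℤ; +_; -[1+_]; 0ℤ; _+_; _-_; _*_; _≤_; _<_; +≤+; +<+; -≤+; -≤-; ∣_∣; positive)
  open import Data.Integer.Properties
  open import Data.Integer.DivMod using (_/_; _%ℕ_; _/ℕ_; a≡a%ℕn+[a/ℕn]*n; div-pos-is-/ℕ; n%ℕd<d)
  open import Data.Integer.Tactic.RingSolver using (solve-∀; solve)
  open import Algebra.Properties.AbelianGroup +-0-abelianGroup
    using (∙-cancelˡ; ∙-cancelʳ; x≈z//y; //-rightDividesˡ)
  open import Data.List.Membership.DecPropositional ℕ._≟_ using (_∈?_)
  import Data.List.Relation.Unary.All as All
  open import Relation.Nullary.Decidable using (toWitness; _×-dec_)

  i*n%ℕn≡0 : ∀ i d → (i * + suc d) %ℕ suc d ≡ 0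
  i*n%ℕn≡0 (+ j) d rewrite sym (pos-* j (suc d)) = ℕ.m*n%n≡0 j (suc d)
  i*n%ℕn≡0 -[1+ j ] d with (suc j ℕ.* suc d) ℕ.% suc d | ℕ.m*n%n≡0 (suc j) (suc d)
  ... | .0 | refl = refl

  i%ℕn≡0⇒i/n*n≡i : ∀ i d → i %ℕ suc d ≡ 0 → (i / + suc d) * + suc d ≡ i
  i%ℕn≡0⇒i/n*n≡i i d i%n≡0 = sym (begin
    i                               ≡⟨ a≡a%ℕn+[a/ℕn]*n i (suc d) ⟩
    + (i %ℕ suc d) + (i /ℕ suc d) * + suc d
      ≡⟨ cong₂ (λ r q → + r + q * + suc d) i%n≡0 (sym (div-pos-is-/ℕ i (suc d))) ⟩
    0ℤ + (i / + suc d) * + suc d    ≡⟨ +-identityˡ _ ⟩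
    (i / + suc d) * + suc d         ∎)
    where open ≡-Reasoning

  m%n≡k%n⇒m-k≡[m/n-k/n]*n : ∀ m k d → m ℕ.% suc d ≡ k ℕ.% suc d →
    + m - + k ≡ (+ (m ℕ./ suc d) - + (k ℕ./ suc d)) * + suc d
  m%n≡k%n⇒m-k≡[m/n-k/n]*n m k d m%n≡k%n = begin
    + m - + k                                             ≡⟨ cong₂ _-_ (divMod m) (divMod k) ⟩
    + (m ℕ.% suc d) + + qₘ * + suc d - (+ r + + qₖ * + suc d)
      ≡⟨ cong (λ x → + x + + qₘ * + suc d - (+ r + + qₖ * + suc d)) m%n≡k%n ⟩
    + r + + qₘ * + suc d - (+ r + + qₖ * + suc d)         ≡⟨ cancel (+ r) (+ qₘ) (+ qₖ) (+ suc d) ⟩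
    (+ qₘ - + qₖ) * + suc d                               ∎
    where
    open ≡-Reasoning
    qₘ = m ℕ./ suc d
    qₖ = k ℕ./ suc d
    r = k ℕ.% suc d
    divMod : ∀ n → + n ≡ + (n ℕ.% suc d) + + (n ℕ./ suc d) * + suc d
    divMod n = trans (cong +_ (ℕ.m≡m%n+[m/n]*n n (suc d)))
                     (cong (λ x → + (n ℕ.% suc d) + x) (pos-* (n ℕ./ suc d) (suc d)))
    cancel : ∀ x y z w → x + y * w - (x + z * w) ≡ (y - z) * w
    cancel = solve-∀

  x+y≡z⇒x≡z-y : ∀ {x y z} → x + y ≡ z → x ≡ z - y
  x+y≡z⇒x≡z-y {x} {y} = x≈z//y x y _

  i≤∣i∣ : ∀ i → i ≤ + ∣ i ∣
  i≤∣i∣ (+ n) = ≤-refl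
  i≤∣i∣ -[1+ n ] = -≤+

  i≤j⇔i-j≤0 : ∀ {i j} → i ≤ j ⇔ i - j ≤ 0ℤ
  i≤j⇔i-j≤0 = mk⇔ i≤j⇒i-j≤0 i-j≤0⇒i≤j

  i≡j⇔i-j≡0 : ∀ {i j} → i ≡ j ⇔ i - j ≡ 0ℤ
  i≡j⇔i-j≡0 {i} {j} = mk⇔ i≡j⇒i-j≡0 (i-j≡0⇒i≡j i j)

  n*x≡y⇒[x≤0⇔y≤0] : ∀ n {x y} .{{_ : ℕ.NonZero n}} → + n * x ≡ y → x ≤ 0ℤ ⇔ y ≤ 0ℤ
  n*x≡y⇒[x≤0⇔y≤0] n {x} {y} n*x≡y = mk⇔
    (λ x≤0 → subst₂ _≤_ n*x≡y (*-zeroʳ (+ n)) (*-monoˡ-≤-nonNeg (+ n) x≤0))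
    (λ y≤0 → *-cancelˡ-≤-pos x 0ℤ (+ n) {{positive (+<+ (ℕ.>-nonZero⁻¹ n))}}
               (subst₂ _≤_ (sym n*x≡y) (sym (*-zeroʳ (+ n))) y≤0))

  n*x≡y⇒[x≡0⇔y≡0] : ∀ n {x y} .{{_ : ℕ.NonZero n}} → + n * x ≡ y → x ≡ 0ℤ ⇔ y ≡ 0ℤ
  n*x≡y⇒[x≡0⇔y≡0] n {x} {y} n*x≡y = mk⇔
    (λ x≡0 → trans (sym n*x≡y) (trans (cong (+ n *_) x≡0) (*-zeroʳ (+ n))))
    (λ y≡0 → *-cancelˡ-≡ (+ n) x 0ℤ (trans n*x≡y (trans y≡0 (sym (*-zeroʳ (+ n))))))

  Least : (ℕ → Set) → Set
  Least P = ∃[ i ] (P i × ∀ j → j ℕ.< i → ¬ P j)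

  extend-least : ∀ {P Q : ℕ → Set} → (∀ {i} → P i → (∀ j → j ℕ.< i → ¬ P j) → Q i) →
                 Least P → ∃[ i ] (P i × (∀ j → j ℕ.< i → ¬ P j) × Q i)
  extend-least f (i , pᵢ , below) = i , pᵢ , below , f pᵢ below

  least : ∀ {P : ℕ → Set} → Decidable P → ∃[ m ] P m → Least P
  least {P} P? (m , pm) = <-rec (λ m → P m → Least P) search m pm
    where
    search : ∀ m → (∀ {k} → k ℕ.< m → P k → Least P) → P m → Least P
    search m below pm with ℕ.anyUpTo? P? m
    ... | yes (k , k<m , pk) = below k<m pk
    ... | no ¬earlier = m , pm , λ j j<m pj → ¬earlier (j , j<m , pj)

  digits : List ℕ
  digits = 1 ∷ 2 ∷ 3 ∷ 4 ∷ 5 ∷ 6 ∷ 7 ∷ 8 ∷ 9 ∷ []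

  suc∈digits : ∀ {k} → k ℕ.< 9 → suc k ∈ digits
  suc∈digits = toWitness {a? = ℕ.allUpTo? (λ k → suc k ∈? digits) 9} _

  digits-bounded : ∀ {b} → b ∈ digits → 1 ℕ.≤ b × b ℕ.≤ 9
  digits-bounded = All.lookup (toWitness {a? = All.all? (λ b → (1 ℕ.≤? b) ×-dec (b ℕ.≤? 9)) digits} _)

  ≡-digit-mod9 : ∀ x → ∃[ b ] (b ∈ digits × ∃[ c ] x ≡ + b + c * + 9)
  ≡-digit-mod9 x with x %ℕ 9 | a≡a%ℕn+[a/ℕn]*n x 9 | n%ℕd<d x 9
  ... | zero  | x≡0+q*9 | _   =
    9 , suc∈digits (ℕ.n<1+n 8) , x /ℕ 9 - + 1 , trans x≡0+q*9 (borrow (x /ℕ 9))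
    where
    borrow : ∀ q → + 0 + q * + 9 ≡ + 9 + (q - + 1) * + 9
    borrow = solve-∀
  ... | suc j | x≡r+q*9 | r<9 = suc j , suc∈digits (ℕ.<-trans (ℕ.n<1+n j) r<9) , x /ℕ 9 , x≡r+q*9

  digitFrom-preserves : ∀ {P : ℕ → Set} a n bs → P 9 → (∀ {b} → b ∈ bs → P b) → P (digitFrom a n bs)
  digitFrom-preserves a n []       p9 _ = p9
  digitFrom-preserves a n (b ∷ bs) p9 p with (n - + a * + b) %ℕ 9
  ... | zero  = p (here refl)
  ... | suc _ = digitFrom-preserves a n bs p9 (p ∘ there)

  digitFrom-sound : ∀ a n bs {b} → b ∈ bs → (n - + a * + b) %ℕ 9 ≡ 0 →
                    (n - + a * + digitFrom a n bs) %ℕ 9 ≡ 0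
  digitFrom-sound a n (b ∷ bs) b∈ hb with (n - + a * + b) %ℕ 9 in eq
  digitFrom-sound a n (b ∷ bs) b∈           hb | zero  = eq
  digitFrom-sound a n (b ∷ bs) (here refl)  hb | suc _ = contradiction (trans (sym hb) eq) λ ()
  digitFrom-sound a n (b ∷ bs) (there b∈bs) hb | suc _ = digitFrom-sound a n bs b∈bs hb

  digit-bounds : ∀ a n → 1 ℕ.≤ digit a n × digit a n ℕ.≤ 9
  digit-bounds a n = digitFrom-preserves a n digits (s≤s z≤n , ℕ.≤-refl) digits-bounded

  InverseMod9 : ℕ → Set
  InverseMod9 a = ∃[ a′ ] ∃[ t ] (a′ * + a ≡ + 1 + + 9 * t)

  A6⇒InverseMod9 : ∀ {a} → a ∈ (1 ∷ 5 ∷ 7 ∷ 11 ∷ 13 ∷ 17 ∷ []) → InverseMod9 a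
  A6⇒InverseMod9 (here refl)                                         = + 1 , + 0  , refl
  A6⇒InverseMod9 (there (here refl))                                 = + 2 , + 1  , refl
  A6⇒InverseMod9 (there (there (here refl)))                         = + 4 , + 3  , refl
  A6⇒InverseMod9 (there (there (there (here refl))))                 = + 5 , + 6  , refl
  A6⇒InverseMod9 (there (there (there (there (here refl)))))         = + 7 , + 10 , refl
  A6⇒InverseMod9 (there (there (there (there (there (here refl)))))) = + 8 , + 15 , refl

  inverse-cancel : ∀ A a′ t → a′ * A ≡ + 1 + + 9 * t →
                   ∀ x y → A * x ≡ + 9 * y → x ≡ + 9 * (a′ * y - t * x)
  inverse-cancel A a′ t a′A≡1+9t x y Ax≡9y = begin
    x                              ≡⟨ solve (x ∷ t ∷ []) ⟩
    (+ 1 + + 9 * t) * x - + 9 * t * x ≡⟨ cong (λ u → u * x - + 9 * t * x) (sym a′A≡1+9t) ⟩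
    a′ * A * x - + 9 * t * x        ≡⟨ cong (_- + 9 * t * x) (*-assoc a′ A x) ⟩
    a′ * (A * x) - + 9 * t * x      ≡⟨ cong (λ u → a′ * u - + 9 * t * x) Ax≡9y ⟩
    a′ * (+ 9 * y) - + 9 * t * x    ≡⟨ solve (a′ ∷ y ∷ t ∷ x ∷ []) ⟩
    + 9 * (a′ * y - t * x)          ∎
    where open ≡-Reasoning

  inverse-residue : ∀ A a′ t → a′ * A ≡ + 1 + + 9 * t → ∀ n b c → a′ * n ≡ b + c * + 9 →
                    n - A * b ≡ (A * c - t * n) * + 9
  inverse-residue A a′ t a′A≡1+9t n b c a′n≡b+9c = begin
    n - A * b
      ≡⟨ solve (n ∷ A ∷ b ∷ a′ ∷ c ∷ []) ⟩
    n - a′ * A * n + A * (a′ * n - (b + c * + 9)) + A * c * + 9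
      ≡⟨ cong₂ (λ u v → n - u * n + A * (v - (b + c * + 9)) + A * c * + 9) a′A≡1+9t a′n≡b+9c ⟩
    n - (+ 1 + + 9 * t) * n + A * ((b + c * + 9) - (b + c * + 9)) + A * c * + 9
      ≡⟨ solve (n ∷ t ∷ A ∷ b ∷ c ∷ []) ⟩
    (A * c - t * n) * + 9
      ∎
    where open ≡-Reasoning

  digit-divides : ∀ {a} → InverseMod9 a → ∀ n → (n - + a * + digit a n) %ℕ 9 ≡ 0
  digit-divides {a} (a′ , t , a′a≡1+9t) n with ≡-digit-mod9 (a′ * n)
  ... | b , b∈ , c , a′n≡b+9c = digitFrom-sound a n digits b∈
    (subst (λ x → x %ℕ 9 ≡ 0) (sym (inverse-residue (+ a) a′ t a′a≡1+9t n (+ b) c a′n≡b+9c))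
           (i*n%ℕn≡0 (+ a * c - t * n) 8))

  quad : ℤ → ℤ → ℤ
  quad c x = c * x + + 9 * (x * x)

  quadℕ : ℕ → ℕ → ℕ
  quadℕ a n = a ℕ.* n ℕ.+ 9 ℕ.* (n ℕ.* n)

  quad-+ : ∀ a n → quad (+ a) (+ n) ≡ + quadℕ a n
  quad-+ a n = sym (cong₂ _+_ (pos-* a n) (trans (pos-* 9 (n ℕ.* n)) (cong (+ 9 *_) (pos-* n n))))

  quad-shift : ∀ c P E b → quad c (P + E * b) ≡ E * (c * b + + 9 * (b * (P + E * b + P))) + quad c P
  quad-shift c P E b = begin
    c * (P + E * b) + + 9 * ((P + E * b) * (P + E * b))         ≡⟨ solve (c ∷ P ∷ E ∷ b ∷ []) ⟩
    E * (c * b + + 9 * (b * (P + E * b + P))) + (c * P + + 9 * (P * P)) ∎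
    where open ≡-Reasoning

  quadℕ-mono-≤ : ∀ a {m n} → m ℕ.≤ n → quadℕ a m ℕ.≤ quadℕ a n
  quadℕ-mono-≤ a m≤n = ℕ.+-mono-≤ (ℕ.*-monoʳ-≤ a m≤n) (ℕ.*-monoʳ-≤ 9 (ℕ.*-mono-≤ m≤n m≤n))

  quadℕ-mono-< : ∀ a {m n} → m ℕ.< n → quadℕ a m ℕ.< quadℕ a n
  quadℕ-mono-< a m<n = ℕ.+-mono-≤-< (ℕ.*-monoʳ-≤ a (ℕ.<⇒≤ m<n)) (ℕ.*-monoʳ-< 9 (ℕ.*-mono-< m<n m<n))

  quadℕ-≤⇔ : ∀ a {m n} → m ℕ.≤ n ⇔ quadℕ a m ℕ.≤ quadℕ a n
  quadℕ-≤⇔ a {m} {n} = mk⇔ (quadℕ-mono-≤ a) λ q≤q → ℕ.≮⇒≥ λ n<m → ℕ.<⇒≱ (quadℕ-mono-< a n<m) q≤q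

  n≤quadℕ : ∀ a n → n ℕ.≤ quadℕ a n
  n≤quadℕ a zero    = z≤n
  n≤quadℕ a (suc n) = ℕ.≤-trans (ℕ.m≤m*n (suc n) (suc n))
                        (ℕ.≤-trans (ℕ.m≤n*m (suc n ℕ.* suc n) 9) (ℕ.m≤n+m _ (a ℕ.* suc n)))

  square-expansion : ∀ a p → (a ℕ.+ 18 ℕ.* p) ^ 2 ≡ a ^ 2 ℕ.+ quadℕ a p ℕ.* 36
  square-expansion = expand
    where
    expand : ∀ a p → (a ℕ.+ 18 ℕ.* p) ℕ.* ((a ℕ.+ 18 ℕ.* p) ℕ.* 1)
                     ≡ a ℕ.* (a ℕ.* 1) ℕ.+ (a ℕ.* p ℕ.+ 9 ℕ.* (p ℕ.* p)) ℕ.* 36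
    expand = ℕ.solve-∀

  N₀-exact : ∀ a N → N ℕ.% 36 ≡ a ^ 2 ℕ.% 36 → + N ≡ + (a ^ 2) + N₀ a N * + 36
  N₀-exact a N N≡a² = begin
    + N                           ≡⟨ sym (//-rightDividesˡ (+ (a ^ 2)) (+ N)) ⟩
    + N - + (a ^ 2) + + (a ^ 2)
      ≡⟨ cong (_+ + (a ^ 2)) (sym (i%ℕn≡0⇒i/n*n≡i (+ N - + (a ^ 2)) 35 divisible)) ⟩
    N₀ a N * + 36 + + (a ^ 2)     ≡⟨ +-comm (N₀ a N * + 36) (+ (a ^ 2)) ⟩
    + (a ^ 2) + N₀ a N * + 36     ∎
    where
    open ≡-Reasoning
    divisible : (+ N - + (a ^ 2)) %ℕ 36 ≡ 0
    divisible = subst (λ x → x %ℕ 36 ≡ 0) (sym (m%n≡k%n⇒m-k≡[m/n-k/n]*n N (a ^ 2) 35 N≡a²))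
                      (i*n%ℕn≡0 (+ (N ℕ./ 36) - + (a ^ 2 ℕ./ 36)) 35)

  square⇔N₀≡quad : ∀ a N → N ℕ.% 36 ≡ a ^ 2 ℕ.% 36 →
                   ∀ p → N ≡ (a ℕ.+ 18 ℕ.* p) ^ 2 ⇔ N₀ a N ≡ quad (+ a) (+ p)
  square⇔N₀≡quad a N N≡a² p = mk⇔
    (λ N≡sq → trans (*-cancelʳ-≡ _ _ (+ 36) (∙-cancelˡ (+ (a ^ 2)) _ _ (begin
      + (a ^ 2) + N₀ a N * + 36 ≡⟨ sym (N₀-exact a N N≡a²) ⟩
      + N                       ≡⟨ cong +_ (trans N≡sq (square-expansion a p)) ⟩
      + (a ^ 2) + + (q ℕ.* 36)  ≡⟨ cong (_+_ (+ (a ^ 2))) (pos-* q 36) ⟩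
      + (a ^ 2) + + q * + 36    ∎))) (sym (quad-+ a p)))
    (λ N₀≡quad → trans (+-injective (begin
      + N                       ≡⟨ N₀-exact a N N≡a² ⟩
      + (a ^ 2) + N₀ a N * + 36 ≡⟨ cong (λ x → + (a ^ 2) + x * + 36) (trans N₀≡quad (quad-+ a p)) ⟩
      + (a ^ 2) + + q * + 36    ≡⟨ cong (_+_ (+ (a ^ 2))) (sym (pos-* q 36)) ⟩
      + (a ^ 2 ℕ.+ q ℕ.* 36)    ∎)) (sym (square-expansion a p)))
    where
    open ≡-Reasoning
    q = quadℕ a p

  i-j≡k⇒i≡j+k : ∀ {i j k} → i - j ≡ k → i ≡ j + k
  i-j≡k⇒i≡j+k {i} {j} refl = trans (sym (//-rightDividesˡ j i)) (+-comm (i - j) j)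

  A[r-b]≡9[f-rS] : ∀ A r b f S n → n ≡ A * r + + 9 * (r * S) → f * + 9 + A * b ≡ n →
                   A * (r - b) ≡ + 9 * (f - r * S)
  A[r-b]≡9[f-rS] A r b f S n n≡Ar+9rS 9f+Ab≡n = begin
    A * (r - b)                                              ≡⟨ solve (A ∷ r ∷ b ∷ f ∷ S ∷ []) ⟩
    A * r + + 9 * (r * S) - (f * + 9 + A * b) + + 9 * (f - r * S)
      ≡⟨ cong₂ (λ u v → u - v + + 9 * (f - r * S)) (sym n≡Ar+9rS) 9f+Ab≡n ⟩
    n - n + + 9 * (f - r * S)                                ≡⟨ solve (n ∷ f ∷ r ∷ S ∷ []) ⟩
    + 9 * (f - r * S)                                        ∎
    where open ≡-Reasoning

  [P+Er]-[P+Eb]≡9Es : ∀ P E r b s → r - b ≡ + 9 * s → P + E * r - (P + E * b) ≡ + 9 * E * s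
  [P+Er]-[P+Eb]≡9Es P E r b s r-b≡9s = begin
    P + E * r - (P + E * b) ≡⟨ solve (P ∷ E ∷ r ∷ b ∷ []) ⟩
    E * (r - b)             ≡⟨ cong (E *_) r-b≡9s ⟩
    E * (+ 9 * s)           ≡⟨ solve (E ∷ s ∷ []) ⟩
    + 9 * E * s             ∎
    where open ≡-Reasoning

  r-b≡9s⇒0≤s : ∀ {r s b} → 0ℤ < r → b ℕ.≤ 9 → r - + b ≡ + 9 * s → 0ℤ ≤ s
  r-b≡9s⇒0≤s {s = + _} _ _ _ = +≤+ z≤n
  r-b≡9s⇒0≤s {r} { -[1+ k ]} {b} 0<r b≤9 r-b≡9s =
    contradiction (drop‿-≤- -8≤-9) (ℕ.<⇒≱ (ℕ.n<1+n 7))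
    where
    -8≤-9 : -[1+ 7 ] ≤ -[1+ 8 ]
    -8≤-9 = begin
      + 1 - + 9            ≤⟨ +-mono-≤ (i<j⇒suc[i]≤j 0<r) (neg-mono-≤ (+≤+ b≤9)) ⟩
      r - + b              ≡⟨ r-b≡9s ⟩
      + 9 * -[1+ k ]       ≤⟨ *-monoˡ-≤-nonNeg (+ 9) (-≤- z≤n) ⟩
      -[1+ 8 ]             ∎
      where open ≤-Reasoning

  module Procedure {a : ℕ} (inverse : InverseMod9 a) (N : ℕ) where

    frac-exact : ∀ i → fracAt a N i * + 9 + + a * + bAt a N i ≡ NAt a N i
    frac-exact i = trans
      (cong (_+ + a * + bAt a N i)
            (i%ℕn≡0⇒i/n*n≡i (NAt a N i - + a * + bAt a N i) 8 (digit-divides inverse (NAt a N i))))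
      (//-rightDividesˡ (+ a * + bAt a N i) (NAt a N i))

    invariant : ∀ i → + (9 ^ i) * NAt a N i + quad (+ a) (pPrev a N i) ≡ N₀ a N
    invariant zero = trans (cong₂ _+_ (*-identityˡ (N₀ a N)) (cong (_+ 0ℤ) (*-zeroʳ (+ a))))
                           (+-identityʳ (N₀ a N))
    invariant (suc i) = begin
      + (9 ^ suc i) * (fr - b * S) + quad A (P + E * b)
        ≡⟨ cong₂ (λ c q → c * (fr - b * S) + q) (pos-* 9 (9 ^ i)) (quad-shift A P E b) ⟩
      + 9 * E * (fr - b * S) + (E * (A * b + + 9 * (b * S)) + quad A P)
        ≡⟨ regroup E fr b S A (quad A P) ⟩
      E * (fr * + 9 + A * b) + quad A P
        ≡⟨ cong (λ x → E * x + quad A P) (frac-exact i) ⟩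
      E * NAt a N i + quad A P
        ≡⟨ invariant i ⟩
      N₀ a N ∎
      where
      open ≡-Reasoning
      A = + a
      E = + (9 ^ i)
      P = pPrev a N i
      b = + bAt a N i
      fr = fracAt a N i
      S = P + E * b + P
      regroup : ∀ E fr b S A Q →
        + 9 * E * (fr - b * S) + (E * (A * b + + 9 * (b * S)) + Q) ≡ E * (fr * + 9 + A * b) + Q
      regroup = solve-∀

    excess-scaled : ∀ i → + (9 ^ suc i) * (fracAt a N i - fAt a N i) ≡ N₀ a N - quad (+ a) (pAt a N i)
    excess-scaled i = x+y≡z⇒x≡z-y (invariant (suc i))

    stops⇔ : ∀ i → Stops a N i ⇔ N₀ a N ≤ quad (+ a) (pAt a N i)
    stops⇔ i = ⇔-sym i≤j⇔i-j≤0
           ⇔-∘ (n*x≡y⇒[x≤0⇔y≤0] (9 ^ suc i) {{ℕ.m^n≢0 9 (suc i)}} (excess-scaled i) ⇔-∘ i≤j⇔i-j≤0)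

    frac≡f⇔ : ∀ i → fracAt a N i ≡ fAt a N i ⇔ N₀ a N ≡ quad (+ a) (pAt a N i)
    frac≡f⇔ i = ⇔-sym i≡j⇔i-j≡0
            ⇔-∘ (n*x≡y⇒[x≡0⇔y≡0] (9 ^ suc i) {{ℕ.m^n≢0 9 (suc i)}} (excess-scaled i) ⇔-∘ i≡j⇔i-j≡0)

    pPrev-natural : ∀ i → ∃[ n ] (pPrev a N i ≡ + n × i ℕ.≤ n)
    pPrev-natural zero = 0 , refl , z≤n
    pPrev-natural (suc i) with pPrev-natural i
    ... | n , pᵢ₋₁≡n , i≤n =
      n ℕ.+ 9 ^ i ℕ.* b , cong₂ _+_ pᵢ₋₁≡n (sym (pos-* (9 ^ i) b)) ,
      subst (ℕ._≤ n ℕ.+ 9 ^ i ℕ.* b) (ℕ.+-comm i 1) (ℕ.+-mono-≤ i≤n (ℕ.*-mono-≤ (ℕ.m^n>0 9 i) b≥1))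
      where
      b = bAt a N i
      b≥1 = proj₁ (digit-bounds a (NAt a N i))

    pAt-natural : ∀ i → ∃[ n ] (pAt a N i ≡ + n × suc i ℕ.≤ n)
    pAt-natural i = pPrev-natural (suc i)

    stops-eventually : ∃[ i ] Stops a N i
    stops-eventually with pAt-natural ∣ N₀ a N ∣
    ... | n , pₖ≡n , k<n = ∣ N₀ a N ∣ , Equivalence.from (stops⇔ ∣ N₀ a N ∣) (begin
      N₀ a N                     ≤⟨ i≤∣i∣ (N₀ a N) ⟩
      + ∣ N₀ a N ∣               ≤⟨ +≤+ (ℕ.≤-trans (ℕ.<⇒≤ k<n) (n≤quadℕ a n)) ⟩
      + quadℕ a n                ≡⟨ sym (quad-+ a n) ⟩
      quad (+ a) (+ n)           ≡⟨ cong (quad (+ a)) (sym pₖ≡n) ⟩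
      quad (+ a) (pAt a N ∣ N₀ a N ∣) ∎)
      where open ≤-Reasoning

    first-stop : Least (Stops a N)
    first-stop = least (λ i → fracAt a N i ≤? fAt a N i) stops-eventually

    remainder-step : ∀ {x} → N₀ a N ≡ quad (+ a) x → ∀ i r → x - pPrev a N i ≡ + (9 ^ i) * r →
                     ∃[ s ] (r - + bAt a N i ≡ + 9 * s × x - pAt a N i ≡ + (9 ^ suc i) * s)
    remainder-step {x} root i r x-P≡Er = s , r-b≡9s , (begin
      x - (P + E * b)          ≡⟨ cong (_- (P + E * b)) x≡P+Er ⟩
      P + E * r - (P + E * b)  ≡⟨ [P+Er]-[P+Eb]≡9Es P E r b s r-b≡9s ⟩
      + 9 * E * s              ≡⟨ cong (_* s) (sym (pos-* 9 (9 ^ i))) ⟩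
      + (9 ^ suc i) * s        ∎)
      where
      open ≡-Reasoning
      A = + a
      E = + (9 ^ i)
      P = pPrev a N i
      b = + bAt a N i
      S = P + E * r + P
      x≡P+Er : x ≡ P + E * r
      x≡P+Er = i-j≡k⇒i≡j+k x-P≡Er
      EN≡E[Ar+9rS] : E * NAt a N i ≡ E * (A * r + + 9 * (r * S))
      EN≡E[Ar+9rS] = ∙-cancelʳ (quad A P) _ _
        (trans (invariant i) (trans root (trans (cong (quad A) x≡P+Er) (quad-shift A P E r))))
      N≡Ar+9rS : NAt a N i ≡ A * r + + 9 * (r * S)
      N≡Ar+9rS = *-cancelˡ-≡ E _ _ {{ℕ.m^n≢0 9 i}} EN≡E[Ar+9rS]
      a′ = proj₁ inverse
      t = proj₁ (proj₂ inverse)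
      s = a′ * (fracAt a N i - r * S) - t * (r - b)
      r-b≡9s : r - b ≡ + 9 * s
      r-b≡9s = inverse-cancel A a′ t (proj₂ (proj₂ inverse)) (r - b) (fracAt a N i - r * S)
        (A[r-b]≡9[f-rS] A r b (fracAt a N i) S (NAt a N i) N≡Ar+9rS (frac-exact i))

    module _ {p : ℕ} (p≥1 : 1 ℕ.≤ p) (root : N₀ a N ≡ quad (+ a) (+ p)) where

      stops⇔p≤pᵢ : ∀ i {n} → pAt a N i ≡ + n → Stops a N i ⇔ p ℕ.≤ n
      stops⇔p≤pᵢ i {n} pᵢ≡n = ⇔-sym (quadℕ-≤⇔ a) ⇔-∘ (mk⇔ drop‿+≤+ +≤+ ⇔-∘ stops⇔quad)
        where
        stops⇔quad : Stops a N i ⇔ + quadℕ a p ≤ + quadℕ a n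
        stops⇔quad = subst₂ (λ x y → Stops a N i ⇔ x ≤ y)
          (trans root (quad-+ a p)) (trans (cong (quad (+ a)) pᵢ≡n) (quad-+ a n)) (stops⇔ i)

      remainder : ∀ i → (∀ j → j ℕ.< i → ¬ Stops a N j) →
                  ∃[ r ] (0ℤ < r × + p - pPrev a N i ≡ + (9 ^ i) * r)
      next-remainder : ∀ i → (∀ j → j ℕ.< i → ¬ Stops a N j) →
                       ∃[ s ] (0ℤ ≤ s × + p - pAt a N i ≡ + (9 ^ suc i) * s)

      remainder zero _ = + p , +<+ p≥1 , trans (+-identityʳ (+ p)) (sym (*-identityˡ (+ p)))
      remainder (suc i) before = s , ≰⇒> s≰0 , p-pᵢ≡cs
        where
        next : ∃[ s ] (0ℤ ≤ s × + p - pAt a N i ≡ + (9 ^ suc i) * s)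
        next = next-remainder i (λ j j<i → before j (ℕ.m<n⇒m<1+n j<i))
        s : ℤ
        s = proj₁ next
        p-pᵢ≡cs : + p - pAt a N i ≡ + (9 ^ suc i) * s
        p-pᵢ≡cs = proj₂ (proj₂ next)
        n : ℕ
        n = proj₁ (pAt-natural i)
        pᵢ≡n : pAt a N i ≡ + n
        pᵢ≡n = proj₁ (proj₂ (pAt-natural i))
        n<p : n ℕ.< p
        n<p = ℕ.≰⇒> (before i (ℕ.n<1+n i) ∘ Equivalence.from (stops⇔p≤pᵢ i pᵢ≡n))
        s≰0 : ¬ s ≤ 0ℤ
        s≰0 s≤0 = ℕ.<⇒≱ n<p (drop‿+≤+ (subst (+ p ≤_) pᵢ≡n (i-j≤0⇒i≤j
          (Equivalence.to (n*x≡y⇒[x≤0⇔y≤0] (9 ^ suc i) {{ℕ.m^n≢0 9 (suc i)}} (sym p-pᵢ≡cs)) s≤0))))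

      next-remainder i before = s , r-b≡9s⇒0≤s 0<r b≤9 r-b≡9s , p-pᵢ≡cs
        where
        prev : ∃[ r ] (0ℤ < r × + p - pPrev a N i ≡ + (9 ^ i) * r)
        prev = remainder i before
        r : ℤ
        r = proj₁ prev
        0<r : 0ℤ < r
        0<r = proj₁ (proj₂ prev)
        step : ∃[ s ] (r - + bAt a N i ≡ + 9 * s × + p - pAt a N i ≡ + (9 ^ suc i) * s)
        step = remainder-step root i r (proj₂ (proj₂ prev))
        s : ℤ
        s = proj₁ step
        r-b≡9s : r - + bAt a N i ≡ + 9 * s
        r-b≡9s = proj₁ (proj₂ step)
        p-pᵢ≡cs : + p - pAt a N i ≡ + (9 ^ suc i) * s
        p-pᵢ≡cs = proj₂ (proj₂ step)
        b≤9 : bAt a N i ℕ.≤ 9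
        b≤9 = proj₂ (digit-bounds a (NAt a N i))

      root-at-stop : ∀ i → Stops a N i → (∀ j → j ℕ.< i → ¬ Stops a N j) → + p ≡ pAt a N i
      root-at-stop i stop before = ≤-antisym p≤pᵢ pᵢ≤p
        where
        next : ∃[ s ] (0ℤ ≤ s × + p - pAt a N i ≡ + (9 ^ suc i) * s)
        next = next-remainder i before
        n : ℕ
        n = proj₁ (pAt-natural i)
        pᵢ≡n : pAt a N i ≡ + n
        pᵢ≡n = proj₁ (proj₂ (pAt-natural i))
        p≤pᵢ : + p ≤ pAt a N i
        p≤pᵢ = subst (+ p ≤_) (sym pᵢ≡n) (+≤+ (Equivalence.to (stops⇔p≤pᵢ i pᵢ≡n) stop))
        pᵢ≤p : pAt a N i ≤ + p
        pᵢ≤p = 0≤i-j⇒j≤i (subst (0ℤ ≤_) (sym (proj₂ (proj₂ next))) 0≤cs)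
          where
          c : ℤ
          c = + (9 ^ suc i)
          0≤cs : 0ℤ ≤ c * proj₁ next
          0≤cs = subst (_≤ c * proj₁ next) (*-zeroʳ c) (*-monoˡ-≤-nonNeg c (proj₁ (proj₂ next)))

    module _ (N≡a² : N ℕ.% 36 ≡ a ^ 2 ℕ.% 36) {i : ℕ} (stop : Stops a N i)
             (before : ∀ j → j ℕ.< i → ¬ Stops a N j) where
      open Equivalence

      square-root-unique : ∀ p → 1 ℕ.≤ p → N ≡ (a ℕ.+ 18 ℕ.* p) ^ 2 → + p ≡ pAt a N i
      square-root-unique p p≥1 N≡sq = root-at-stop p≥1 (to (square⇔N₀≡quad a N N≡a² p) N≡sq) i stop before

      square-root⇔exact : (∃[ p ] (1 ℕ.≤ p × N ≡ (a ℕ.+ 18 ℕ.* p) ^ 2)) ⇔ fracAt a N i ≡ fAt a N i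
      square-root⇔exact = mk⇔
        (λ (p , p≥1 , N≡sq) → from (frac≡f⇔ i)
          (trans (to (square⇔N₀≡quad a N N≡a² p) N≡sq) (cong (quad (+ a)) (square-root-unique p p≥1 N≡sq))))
        (λ frac≡f → n , ℕ.≤-trans (s≤s z≤n) i<n ,
          from (square⇔N₀≡quad a N N≡a² n) (trans (to (frac≡f⇔ i) frac≡f) (cong (quad (+ a)) pᵢ≡n)))
        where
        n : ℕ
        n = proj₁ (pAt-natural i)
        pᵢ≡n : pAt a N i ≡ + n
        pᵢ≡n = proj₁ (proj₂ (pAt-natural i))
        i<n : suc i ℕ.≤ n
        i<n = proj₂ (proj₂ (pAt-natural i))

open import Data.Nat.Base using (ℕ; _+_; _*_; _^_; _<_; _≤_; _%_)
open import Data.Integer.Base using (+_)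

mainTheorem1 : (a N : ℕ) → a ∈ (1 ∷ 5 ∷ 7 ∷ 11 ∷ 13 ∷ 17 ∷ []) → 1 ≤ N →
    N % 36 ≡ (a ^ 2) % 36 →
    ∃[ i ] (Stops a N i × (∀ j → j < i → ¬ Stops a N j)
      × ((∃[ p ] (1 ≤ p × N ≡ (a + 18 * p) ^ 2)) ⇔ (fracAt a N i ≡ fAt a N i))
      × (∀ p → 1 ≤ p → N ≡ (a + 18 * p) ^ 2 → + p ≡ pAt a N i))
mainTheorem1 a N a∈ _ N≡a² = extend-least
  (λ stop before → square-root⇔exact N≡a² stop before , square-root-unique N≡a² stop before)
  first-stop
  where open Procedure (A6⇒InverseMod9 a∈) N
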